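{- Let $r,k$ be positive integers. Then \[\mathcal{P}^{(r,k)}(q,t)=\prod_{i=0}^{k-1}\mathcal{P}^{(r,1)}(q,q^it).\]
   Context: For positive integers $r,k$, an $(r,k)$-parking function of length $n$ is a sequence $(a_1,\dots,a_n)$ of positive integers whose increasing rearrangement $b_1\le\cdots\le b_n$ satisfies $b_i\le k+(i-1)r$; the empty sequence is the unique one of length $0$. For such $\alpha=(a_1,\dots,a_n)$ set $s^{(r,k)}(\alpha)=kn+\binom n2 r-\sum_{i=1}^n a_i$. For a sequence $\beta$ of positive integers in which the value $i$ occurs $m_i$ times, let $U_\beta=h_{m_1}h_{m_2}\cdots$ (with $h_0=1$, $h_m$ the complete homogeneous symmetric function). Define $F_n^{(r,k)}(q)=\sum_\beta q^{s^{(r,k)}(\beta)}U_\beta$, the sum over all weakly increasing $(r,k)$-parking functions $\beta$ of length $n$ (so $F_0^{(r,k)}(q)=1$), and $\mathcal{P}^{(r,k)}(q,t)=\sum_{n\ge0}F_n^{(r,k)}(q)t^n$. -}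

module Defs where

open import Data.Nat using (ℕ; zero; suc; _+_; _*_; _∸_; _≤ᵇ_; _≡ᵇ_)
open import Data.Nat.Properties using (≤-decTotalOrder)
open import Data.Nat.Combinatorics using (_C_)
open import Data.Bool using (Bool; true; false; _∧_; not; if_then_else_)
open import Data.List using (List; []; _∷_; map; concatMap; concat; filter; length; _++_)
open import Data.Nat.ListAction using (sum)
open import Data.Product using (_×_; _,_)
open import Relation.Nullary.Decidable using (T?)
open import Data.List.Sort.InsertionSort.Base ≤-decTotalOrder using (sort)

range : ℕ → ℕ → List ℕ
range a zero    = []
range a (suc l) = a ∷ range (suc a) l

upto : ℕ → List ℕ
upto k = range 0 k

seqs : ℕ → ℕ → List (List ℕ)
seqs M zero    = [] ∷ []
seqs M (suc n) = concatMap (λ a → map (a ∷_) (seqs M n)) (range 1 M)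

isWeaklyIncr : List ℕ → Bool
isWeaklyIncr []           = true
isWeaklyIncr (x ∷ [])     = true
isWeaklyIncr (x ∷ y ∷ xs) = (x ≤ᵇ y) ∧ isWeaklyIncr (y ∷ xs)

-- for a list b_i, b_{i+1}, ... starting at 1-based position i:
-- every entry is positive and b_j ≤ k + (j-1) r
parkBoundFrom : ℕ → ℕ → ℕ → List ℕ → Bool
parkBoundFrom r k i []       = true
parkBoundFrom r k i (b ∷ bs) =
  (1 ≤ᵇ b) ∧ (b ≤ᵇ (k + (i ∸ 1) * r)) ∧ parkBoundFrom r k (suc i) bs

-- b is a weakly increasing (r,k)-parking function
-- (for a weakly increasing sequence the increasing rearrangement is itself)
isWIPF : ℕ → ℕ → List ℕ → Bool
isWIPF r k b = isWeaklyIncr b ∧ parkBoundFrom r k 1 b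

-- all weakly increasing (r,k)-parking functions of length n
-- (entries are bounded by k + (n-1) r, so enumerating {1..k+(n-1)r}^n suffices)
WIPF : ℕ → ℕ → ℕ → List (List ℕ)
WIPF r k n = filter (λ b → T? (isWIPF r k b)) (seqs (k + (n ∸ 1) * r) n)

-- s^{(r,k)}(α) = k n + C(n,2) r - Σ a_i   (nonnegative for parking functions,
-- so truncated subtraction is exact)
stat : ℕ → ℕ → List ℕ → ℕ
stat r k α = (k * length α + (length α C 2) * r) ∸ sum α

-- Elements of ℤ[q] ⊗ Sym written in the basis q^e h_λ.
-- A monomial q^e h_{λ_1} h_{λ_2} ... is (e , λ) with λ the sorted list
-- of positive parts (h_0 = 1 is dropped).  A polynomial is a formal sum,
-- i.e. a list of monomials (each with coefficient 1), compared as
-- multisets (up to permutation).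

Mono : Set
Mono = ℕ × List ℕ

Poly : Set
Poly = List Mono

occ : ℕ → List ℕ → ℕ
occ v []       = 0
occ v (x ∷ xs) = (if v ≡ᵇ x then 1 else 0) + occ v xs

-- the nonzero multiplicities m_i of the values i ≥ 1 occurring in β, sorted
-- (every value occurring in β is ≤ sum β)
multiplicities : List ℕ → List ℕ
multiplicities β =
  sort (filter (λ m → T? (not (m ≡ᵇ 0))) (map (λ i → occ i β) (range 1 (sum β))))

monoOf : ℕ → ℕ → List ℕ → Mono
monoOf r k β = stat r k β , multiplicities β

F : ℕ → ℕ → ℕ → Poly
F r k n = map (monoOf r k) (WIPF r k n)

oneP : Poly
oneP = (0 , []) ∷ []

mulM : Mono → Mono → Mono
mulM (e , λ₁) (e' , μ) = (e + e') , sort (λ₁ ++ μ)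

mulP : Poly → Poly → Poly
mulP xs ys = concatMap (λ x → map (mulM x) ys) xs

shiftP : ℕ → Poly → Poly
shiftP d = map (λ { (e , λ₁) → (e + d) , λ₁ })

-- coefficient of t^n in ∏_{i ∈ is} P^{(r,1)}(q, q^i t)   (Cauchy product):
-- the coefficient of t^m in P^{(r,1)}(q, q^i t) is q^{i m} F_m^{(r,1)}(q).
prodCoeff : ℕ → List ℕ → ℕ → Poly
prodCoeff r []       zero    = oneP
prodCoeff r []       (suc n) = []
prodCoeff r (i ∷ is) n       =
  concatMap (λ m → mulP (shiftP (i * m) (F r 1 m)) (prodCoeff r is (n ∸ m)))
            (range 0 (suc n))

module Submission where

-- A weakly increasing (r,k+1)-parking function b splits uniquely as b = c ++ map (_+ (k + |c| r)) d,
-- where c, the longest prefix of b obeying the (r,k)-bounds, is a weakly increasing (r,k)-parking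
-- function and d is a weakly increasing (r,1)-parking function.  Under this bijection
-- s^{(r,k+1)}(b) = s^{(r,1)}(d) + s^{(r,k)}(c) + |c| and U_b = U_d U_c, which is the identity
-- P^{(r,k+1)}(q,t) = P^{(r,1)}(q,t) P^{(r,k)}(q,qt) read off coefficientwise.  There is no
-- (r,0)-parking function of positive length, so P^{(r,0)} = 1, and iterating gives the product.

open import Defs
open import Data.Bool using (T; true; false; not; if_then_else_)
open import Data.Bool.Properties using (T-∧)
open import Data.Empty using (⊥-elim)
open import Data.Unit using (tt)
open import Data.Nat
  using (ℕ; zero; suc; _+_; _*_; _∸_; _≤_; _<_; z≤n; s≤s; z<s; _≤ᵇ_; _≡ᵇ_; _≤?_; _≟_)
open import Data.Nat.Properties
open import Data.Nat.Combinatorics using (_C_; nCk+nC[k+1]≡[n+1]C[k+1]; nC1≡n)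
open import Data.Nat.ListAction using (sum)
open import Data.Nat.ListAction.Properties using (sum-++)
open import Data.Nat.Solver using (module +-*-Solver)
open import Data.List
  using (List; []; _∷_; _++_; map; concat; concatMap; filter; length; take; drop; cartesianProduct)
open import Data.List.Properties
  using (map-++; map-cong-local; map-id-local; map-∘; map-concatMap; filter-++; filter-none; ++-identityʳ;
         length-++; length-map; length-take; take++drop≡id; map-injective; ∷-injective; ∷-injectiveʳ)
open import Data.List.Membership.Propositional using (_∈_; find; lose)
open import Data.List.Membership.Propositional.Properties
  using (∈-map⁺; ∈-map⁻; ∈-filter⁺; ∈-filter⁻; ∈-concatMap⁺; ∈-concatMap⁻;
         ∈-cartesianProduct⁺; ∈-cartesianProduct⁻)
open import Data.List.Membership.Propositional.Properties.WithK using (unique∧set⇒bag)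
open import Data.List.Relation.Unary.Any using (here; there)
open import Data.List.Relation.Unary.All using (All; []; _∷_)
import Data.List.Relation.Unary.All as All
import Data.List.Relation.Unary.All.Properties as All
open import Data.List.Relation.Unary.AllPairs using ([]; _∷_)
open import Data.List.Relation.Unary.Linked using (Linked; []; [-]; _∷_)
import Data.List.Relation.Unary.Linked as Linked
import Data.List.Relation.Unary.Linked.Properties as Linked
open import Data.List.Relation.Unary.Unique.Propositional using (Unique)
import Data.List.Relation.Unary.Unique.Propositional.Properties as Unique
open import Data.List.Relation.Binary.Permutation.Propositional
  using (_↭_; ↭-refl; ↭-sym; ↭-trans; ↭-reflexive; ↭⇒↭ₛ; module PermutationReasoning)
import Data.List.Relation.Binary.Permutation.Propositional.Properties as ↭
open import Data.List.Relation.Binary.BagAndSetEquality using (∼bag⇒↭)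
open import Data.List.Relation.Binary.Equality.Propositional using (≋⇒≡)
open import Data.List.Relation.Unary.Sorted.TotalOrder.Properties using (↗↭↗⇒≋)
open import Data.List.Sort.InsertionSort.Base ≤-decTotalOrder using (sort)
open import Data.List.Sort.InsertionSort.Properties ≤-decTotalOrder using (sort-↭; sort-↗)
open import Data.Product using (_×_; _,_; proj₁; proj₂; ∃; ∃₂)
open import Function using (_∘_)
open import Level using (Level)
open import Function.Bundles using (mk⇔; Equivalence)
open import Relation.Binary.Core using (Rel)
open import Relation.Binary.PropositionalEquality
  using (_≡_; _≢_; refl; sym; trans; cong; cong₂; subst; module ≡-Reasoning)
open import Relation.Nullary using (Dec; yes; no; ¬_)
open import Relation.Nullary.Decidable using (T?)

private
  variable
    A B : Set
    ℓ : Level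

∈-concatMap⁺′ : (f : A → List B) {xs : List A} {x : A} {y : B} →
  x ∈ xs → y ∈ f x → y ∈ concatMap f xs
∈-concatMap⁺′ f x∈xs y∈fx = ∈-concatMap⁺ f (lose x∈xs y∈fx)

∈-concatMap⁻′ : (f : A → List B) (xs : List A) {y : B} →
  y ∈ concatMap f xs → ∃ λ x → x ∈ xs × y ∈ f x
∈-concatMap⁻′ f xs y∈ = find (∈-concatMap⁻ f {xs} y∈)

concatMap-cong-∈ : {f g : A → List B} (xs : List A) →
  (∀ {x} → x ∈ xs → f x ≡ g x) → concatMap f xs ≡ concatMap g xs
concatMap-cong-∈ xs f≡g = cong concat (map-cong-local (All.tabulate f≡g))

concatMap-↭ : {f g : A → List B} (xs : List A) →
  (∀ x → f x ↭ g x) → concatMap f xs ↭ concatMap g xs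
concatMap-↭ []       f↭g = ↭-refl
concatMap-↭ (x ∷ xs) f↭g = ↭.++⁺ (f↭g x) (concatMap-↭ xs f↭g)

Unique-map⁺ : {f : A → B} {xs : List A} →
  (∀ {x y} → x ∈ xs → y ∈ xs → f x ≡ f y → x ≡ y) → Unique xs → Unique (map f xs)
Unique-map⁺ {xs = []}     inj []         = []
Unique-map⁺ {xs = x ∷ xs} inj (x∉ ∷ uxs) =
  All.map⁺ (All.tabulate λ y∈ fx≡fy → All.lookup x∉ y∈ (inj (here refl) (there y∈) fx≡fy))
  ∷ Unique-map⁺ (λ x∈ y∈ → inj (there x∈) (there y∈)) uxs

Unique-concatMap⁺ : (f : A → List B) {xs : List A} → Unique xs →
  (∀ {x} → x ∈ xs → Unique (f x)) →
  (∀ {x y z} → x ∈ xs → y ∈ xs → z ∈ f x → z ∈ f y → x ≡ y) →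
  Unique (concatMap f xs)
Unique-concatMap⁺ f {[]}     []         uf disj = []
Unique-concatMap⁺ f {x ∷ xs} (x∉ ∷ uxs) uf disj =
  Unique.++⁺ (uf (here refl))
    (Unique-concatMap⁺ f uxs (uf ∘ there) (λ x∈ y∈ → disj (there x∈) (there y∈)))
    λ (z∈fx , z∈rest) → let (y , y∈ , z∈fy) = ∈-concatMap⁻′ f xs z∈rest in
      All.lookup x∉ y∈ (disj (here refl) (there y∈) z∈fx z∈fy)

++-injective : ∀ {xs ys zs ws : List A} → length xs ≡ length ys →
  xs ++ zs ≡ ys ++ ws → xs ≡ ys × zs ≡ ws
++-injective {xs = []}     {[]}     _       eq = refl , eq
++-injective {xs = x ∷ xs} {y ∷ ys} |xs|≡|ys| eq =
  let x≡y , eq′ = ∷-injective eq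
      xs≡ys , zs≡ws = ++-injective (suc-injective |xs|≡|ys|) eq′
  in cong₂ _∷_ x≡y xs≡ys , zs≡ws

sort-cong-↭ : {xs ys : List ℕ} → xs ↭ ys → sort xs ≡ sort ys
sort-cong-↭ {xs} {ys} xs↭ys = ≋⇒≡ (↗↭↗⇒≋ ≤-totalOrder (sort-↗ xs) (sort-↗ ys)
  (↭⇒↭ₛ (↭-trans (sort-↭ xs) (↭-trans xs↭ys (↭-sym (sort-↭ ys))))))

sort-++-sort : ∀ xs ys → sort (xs ++ ys) ≡ sort (sort ys ++ sort xs)
sort-++-sort xs ys =
  sort-cong-↭ (↭-trans (↭.++-comm xs ys) (↭.++⁺ (↭-sym (sort-↭ ys)) (↭-sym (sort-↭ xs))))

∈-range⁻ : ∀ {a l x} → x ∈ range a l → a ≤ x × x < a + l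
∈-range⁻ {a} {suc l}     (here refl) = ≤-refl , m<m+n a z<s
∈-range⁻ {a} {suc l} {x} (there x∈)  =
  let a<x , x<a+l = ∈-range⁻ {suc a} {l} x∈ in <⇒≤ a<x , subst (x <_) (sym (+-suc a l)) x<a+l

∈-range⁺ : ∀ {a l x} → a ≤ x → x < a + l → x ∈ range a l
∈-range⁺ {a} {zero}      a≤x x<a+0 = ⊥-elim (<⇒≱ (subst (_ <_) (+-identityʳ a) x<a+0) a≤x)
∈-range⁺ {a} {suc l} {x} a≤x x<a+l with a ≟ x
... | yes refl = here refl
... | no  a≢x  = there (∈-range⁺ (≤∧≢⇒< a≤x a≢x) (subst (x <_) (+-suc a l) x<a+l))

range-unique : ∀ a l → Unique (range a l)
range-unique a zero    = []
range-unique a (suc l) =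
  All.tabulate (λ a′∈ → <⇒≢ (proj₁ (∈-range⁻ {suc a} {l} a′∈))) ∷ range-unique (suc a) l

range-++ : ∀ a l l′ → range a (l + l′) ≡ range a l ++ range (a + l) l′
range-++ a zero    l′ = cong (λ b → range b l′) (sym (+-identityʳ a))
range-++ a (suc l) l′ =
  cong (a ∷_) (trans (range-++ (suc a) l l′)
    (cong (λ b → range (suc a) l ++ range b l′) (sym (+-suc a l))))

map-range-+ : (f : ℕ → B) (a s l : ℕ) → map f (range (a + s) l) ≡ map (f ∘ (_+ s)) (range a l)
map-range-+ f a s zero    = refl
map-range-+ f a s (suc l) = cong (f (a + s) ∷_) (map-range-+ f (suc a) s l)

module _ {R : Rel A ℓ} where

  Linked-take : ∀ n {xs} → Linked R xs → Linked R (take n xs)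
  Linked-take zero          _         = []
  Linked-take (suc n)       []        = []
  Linked-take (suc zero)    [-]       = [-]
  Linked-take (suc (suc n)) [-]       = [-]
  Linked-take (suc zero)    (_ ∷ _)   = [-]
  Linked-take (suc (suc n)) (r ∷ rs)  = r ∷ Linked-take (suc n) rs

  Linked-drop : ∀ n {xs} → Linked R xs → Linked R (drop n xs)
  Linked-drop zero    rs       = rs
  Linked-drop (suc n) []       = []
  Linked-drop (suc n) [-]      = Linked-drop n []
  Linked-drop (suc n) (_ ∷ rs) = Linked-drop n rs

  Linked-++⁺ : ∀ {xs ys} → Linked R xs → Linked R ys →
    (∀ {x y} → x ∈ xs → y ∈ ys → R x y) → Linked R (xs ++ ys)
  Linked-++⁺ []       rys         across = rys
  Linked-++⁺ [-]      []          across = [-]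
  Linked-++⁺ [-]      [-]         across = across (here refl) (here refl) ∷ [-]
  Linked-++⁺ [-]      (r ∷ rys)   across = across (here refl) (here refl) ∷ r ∷ rys
  Linked-++⁺ (r ∷ rs) rys         across = r ∷ Linked-++⁺ rs rys (across ∘ there)

Linked⇒isWeaklyIncr : ∀ {b} → Linked _≤_ b → T (isWeaklyIncr b)
Linked⇒isWeaklyIncr []          = tt
Linked⇒isWeaklyIncr [-]         = tt
Linked⇒isWeaklyIncr (x≤y ∷ rys) = Equivalence.from T-∧ (≤⇒≤ᵇ x≤y , Linked⇒isWeaklyIncr rys)

isWeaklyIncr⇒Linked : ∀ b → T (isWeaklyIncr b) → Linked _≤_ b
isWeaklyIncr⇒Linked []          _ = []
isWeaklyIncr⇒Linked (x ∷ [])    _ = [-]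
isWeaklyIncr⇒Linked (x ∷ y ∷ b) t =
  let x≤ᵇy , t′ = Equivalence.to (T-∧ {x ≤ᵇ y}) t in
  ≤ᵇ⇒≤ x y x≤ᵇy ∷ isWeaklyIncr⇒Linked (y ∷ b) t′

∈-seqs⁻ : ∀ M n {b} → b ∈ seqs M n → length b ≡ n
∈-seqs⁻ M zero    (here refl) = refl
∈-seqs⁻ M (suc n) b∈ =
  let a , _ , b∈′ = ∈-concatMap⁻′ (λ a → map (a ∷_) (seqs M n)) (range 1 M) b∈
      b′ , b′∈ , b≡ = ∈-map⁻ (a ∷_) b∈′
  in trans (cong length b≡) (cong suc (∈-seqs⁻ M n b′∈))

∈-seqs⁺ : ∀ M {b} → All (λ x → 1 ≤ x × x ≤ M) b → b ∈ seqs M (length b)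
∈-seqs⁺ M []                           = here refl
∈-seqs⁺ M {a ∷ b} ((1≤a , a≤M) ∷ bnds) =
  ∈-concatMap⁺′ (λ a → map (a ∷_) (seqs M (length b)))
    (∈-range⁺ 1≤a (s≤s a≤M)) (∈-map⁺ (a ∷_) (∈-seqs⁺ M bnds))

seqs-unique : ∀ M n → Unique (seqs M n)
seqs-unique M zero    = [] ∷ []
seqs-unique M (suc n) =
  Unique-concatMap⁺ (λ a → map (a ∷_) (seqs M n)) (range-unique 1 M)
    (λ _ → Unique.map⁺ ∷-injectiveʳ (seqs-unique M n))
    λ _ _ z∈ z∈′ →
      head-≡ (proj₂ (proj₂ (∈-map⁻ _ z∈))) (proj₂ (proj₂ (∈-map⁻ _ z∈′)))
  where
  head-≡ : ∀ {a a′ z b b′} → z ≡ a ∷ b → z ≡ a′ ∷ b′ → a ≡ a′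
  head-≡ refl refl = refl

-- Binomial coefficients and sums

suc-C2 : ∀ l → suc l C 2 ≡ l + l C 2
suc-C2 l = trans (sym (nCk+nC[k+1]≡[n+1]C[k+1] l 1)) (cong (_+ l C 2) (nC1≡n l))

+-C2 : ∀ p m → (p + m) C 2 ≡ p C 2 + m C 2 + p * m
+-C2 p zero    = trans (cong (_C 2) (+-identityʳ p))
  (sym (trans (cong₂ _+_ (+-identityʳ (p C 2)) (*-zeroʳ p)) (+-identityʳ (p C 2))))
+-C2 p (suc m) = begin
  (p + suc m) C 2                  ≡⟨ cong (_C 2) (+-suc p m) ⟩
  suc (p + m) C 2                  ≡⟨ suc-C2 (p + m) ⟩
  p + m + (p + m) C 2              ≡⟨ cong (p + m +_) (+-C2 p m) ⟩
  p + m + (p C 2 + m C 2 + p * m)  ≡⟨ solve 4 (λ p m p₂ m₂ → p :+ m :+ (p₂ :+ m₂ :+ p :* m)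
                                                := p₂ :+ (m :+ m₂) :+ p :* (con 1 :+ m))
                                        refl p m (p C 2) (m C 2) ⟩
  p C 2 + (m + m C 2) + p * suc m  ≡⟨ cong (λ x → p C 2 + x + p * suc m) (sym (suc-C2 m)) ⟩
  p C 2 + suc m C 2 + p * suc m    ∎
  where
  open ≡-Reasoning
  open +-*-Solver

sum-shift : ∀ s d → sum (map (_+ s) d) ≡ sum d + length d * s
sum-shift s []      = refl
sum-shift s (x ∷ d) = trans (cong (x + s +_) (sum-shift s d))
  (solve 4 (λ x s Σd l → x :+ s :+ (Σd :+ l :* s) := x :+ Σd :+ (con 1 :+ l) :* s)
    refl x s (sum d) (length d))
  where open +-*-Solver

-- Multiplicities

occ-++ : ∀ v xs ys → occ v (xs ++ ys) ≡ occ v xs + occ v ys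
occ-++ v []       ys = refl
occ-++ v (x ∷ xs) ys = trans (cong (_ +_) (occ-++ v xs ys)) (sym (+-assoc _ (occ v xs) (occ v ys)))

occ-∉ : ∀ v xs → All (v ≢_) xs → occ v xs ≡ 0
occ-∉ v []       []           = refl
occ-∉ v (x ∷ xs) (v≢x ∷ v∉xs) with v ≡ᵇ x in v≡ᵇx
... | true  = ⊥-elim (v≢x (≡ᵇ⇒≡ v x (subst T (sym v≡ᵇx) tt)))
... | false = occ-∉ v xs v∉xs

+-≡ᵇ-cancelˡ : ∀ s i x → (s + i ≡ᵇ s + x) ≡ (i ≡ᵇ x)
+-≡ᵇ-cancelˡ zero    i x = refl
+-≡ᵇ-cancelˡ (suc s) i x = +-≡ᵇ-cancelˡ s i x

+-≡ᵇ-cancelʳ : ∀ s i x → (i + s ≡ᵇ x + s) ≡ (i ≡ᵇ x)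
+-≡ᵇ-cancelʳ s i x rewrite +-comm i s | +-comm x s = +-≡ᵇ-cancelˡ s i x

occ-shift : ∀ s i d → occ (i + s) (map (_+ s) d) ≡ occ i d
occ-shift s i []      = refl
occ-shift s i (x ∷ d) =
  cong₂ _+_ (cong (λ b → if b then 1 else 0) (+-≡ᵇ-cancelʳ s i x)) (occ-shift s i d)

All-≤-sum : ∀ β → All (_≤ sum β) β
All-≤-sum []      = []
All-≤-sum (x ∷ β) =
  m≤m+n x (sum β) ∷ All.map (λ y≤ → ≤-trans y≤ (m≤n+m (sum β) x)) (All-≤-sum β)

nonzero? : (m : ℕ) → Dec (T (not (m ≡ᵇ 0)))
nonzero? m = T? (not (m ≡ᵇ 0))

nonzeroOccs : List ℕ → ℕ → ℕ → List ℕ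
nonzeroOccs β a l = filter nonzero? (map (λ i → occ i β) (range a l))

nonzeroOccs-++ : ∀ β a l l′ →
  nonzeroOccs β a (l + l′) ≡ nonzeroOccs β a l ++ nonzeroOccs β (a + l) l′
nonzeroOccs-++ β a l l′ = begin
  filter nonzero? (map occβ (range a (l + l′)))
    ≡⟨ cong (filter nonzero? ∘ map occβ) (range-++ a l l′) ⟩
  filter nonzero? (map occβ (range a l ++ range (a + l) l′))
    ≡⟨ cong (filter nonzero?) (map-++ occβ (range a l) _) ⟩
  filter nonzero? (map occβ (range a l) ++ map occβ (range (a + l) l′))
    ≡⟨ filter-++ nonzero? (map occβ (range a l)) _ ⟩
  nonzeroOccs β a l ++ nonzeroOccs β (a + l) l′
    ∎
  where
  open ≡-Reasoning
  occβ : ℕ → ℕ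
  occβ i = occ i β

nonzeroOccs-absent : ∀ β a l → (∀ {i} → i ∈ range a l → occ i β ≡ 0) →
  nonzeroOccs β a l ≡ []
nonzeroOccs-absent β a l absent = filter-none nonzero?
  (All.map⁺ (All.tabulate λ i∈ → subst (λ m → ¬ T (not (m ≡ᵇ 0))) (sym (absent i∈)) λ ()))

nonzeroOccs-beyond : ∀ β N l → All (_≤ N) β → nonzeroOccs β 1 (N + l) ≡ nonzeroOccs β 1 N
nonzeroOccs-beyond β N l β≤N = begin
  nonzeroOccs β 1 (N + l)                       ≡⟨ nonzeroOccs-++ β 1 N l ⟩
  nonzeroOccs β 1 N ++ nonzeroOccs β (1 + N) l  ≡⟨ cong (_ ++_) (nonzeroOccs-absent β _ l absent) ⟩
  nonzeroOccs β 1 N ++ []                       ≡⟨ ++-identityʳ _ ⟩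
  nonzeroOccs β 1 N                             ∎
  where
  open ≡-Reasoning
  absent : ∀ {i} → i ∈ range (1 + N) l → occ i β ≡ 0
  absent i∈ = occ-∉ _ β
    (All.map (λ x≤N i≡x → <⇒≱ (proj₁ (∈-range⁻ i∈)) (subst (_≤ N) (sym i≡x) x≤N)) β≤N)

nonzeroOccs-bound-irrelevant : ∀ β N N′ → All (_≤ N) β → All (_≤ N′) β →
  nonzeroOccs β 1 N ≡ nonzeroOccs β 1 N′
nonzeroOccs-bound-irrelevant β N N′ β≤N β≤N′ = begin
  nonzeroOccs β 1 N          ≡⟨ sym (nonzeroOccs-beyond β N N′ β≤N) ⟩
  nonzeroOccs β 1 (N + N′)   ≡⟨ cong (nonzeroOccs β 1) (+-comm N N′) ⟩
  nonzeroOccs β 1 (N′ + N)   ≡⟨ nonzeroOccs-beyond β N′ N β≤N′ ⟩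
  nonzeroOccs β 1 N′         ∎
  where open ≡-Reasoning

multiplicities-glue : ∀ s {c d} → All (_≤ s) c → All (1 ≤_) d →
  multiplicities (c ++ map (_+ s) d) ≡ sort (multiplicities d ++ multiplicities c)
multiplicities-glue s {c} {d} c≤s 1≤d = begin
  sort (nonzeroOccs b 1 (sum b))
    ≡⟨ cong sort (nonzeroOccs-bound-irrelevant b _ _ (All-≤-sum b) b≤) ⟩
  sort (nonzeroOccs b 1 (s + sum d))
    ≡⟨ cong sort (nonzeroOccs-++ b 1 s (sum d)) ⟩
  sort (nonzeroOccs b 1 s ++ nonzeroOccs b (1 + s) (sum d))
    ≡⟨ cong₂ (λ x y → sort (filter nonzero? x ++ filter nonzero? y)) below above ⟩
  sort (nonzeroOccs c 1 s ++ nonzeroOccs d 1 (sum d))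
    ≡⟨ cong (λ x → sort (x ++ _)) (nonzeroOccs-bound-irrelevant c _ _ c≤s (All-≤-sum c)) ⟩
  sort (nonzeroOccs c 1 (sum c) ++ nonzeroOccs d 1 (sum d))
    ≡⟨ sort-++-sort (nonzeroOccs c 1 (sum c)) (nonzeroOccs d 1 (sum d)) ⟩
  sort (multiplicities d ++ multiplicities c)
    ∎
  where
  open ≡-Reasoning
  b : List ℕ
  b = c ++ map (_+ s) d
  b≤ : All (_≤ s + sum d) b
  b≤ = All.++⁺ (All.map (λ x≤s → ≤-trans x≤s (m≤m+n s (sum d))) c≤s)
               (All.map⁺ (All.map (λ {y} y≤ → subst (y + s ≤_) (+-comm (sum d) s) (+-monoˡ-≤ s y≤))
                                  (All-≤-sum d)))
  below : map (λ i → occ i b) (range 1 s) ≡ map (λ i → occ i c) (range 1 s)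
  below = map-cong-local (All.tabulate λ {i} i∈ →
    let i≤s = ≤-pred (proj₂ (∈-range⁻ i∈))
        i∉d = All.map⁺
          (All.map (λ 1≤y i≡ → <⇒≱ (subst (suc s ≤_) (sym i≡) (+-monoˡ-≤ s 1≤y)) i≤s) 1≤d)
    in trans (occ-++ i c _) (trans (cong (occ i c +_) (occ-∉ i _ i∉d)) (+-identityʳ _)))
  above : map (λ i → occ i b) (range (1 + s) (sum d)) ≡ map (λ i → occ i d) (range 1 (sum d))
  above = trans (map-range-+ (λ i → occ i b) 1 s (sum d)) (map-cong-local (All.tabulate λ {i} i∈ →
    let s<i+s = +-monoˡ-≤ s (proj₁ (∈-range⁻ i∈))
        i+s∉c = All.map (λ x≤s i+s≡x → <⇒≱ s<i+s (subst (_≤ s) (sym i+s≡x) x≤s)) c≤s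
    in trans (occ-++ (i + s) c _) (cong₂ _+_ (occ-∉ (i + s) c i+s∉c) (occ-shift s i d))))

-- Polynomials

mulP-map : {A B : Set} (f : A → Mono) (g : B → Mono) (xs : List A) (ys : List B) →
  mulP (map f xs) (map g ys) ≡ map (λ (x , y) → mulM (f x) (g y)) (cartesianProduct xs ys)
mulP-map f g []       ys = refl
mulP-map {A} {B} f g (x ∷ xs) ys = begin
  map (mulM (f x)) (map g ys) ++ mulP (map f xs) (map g ys)
    ≡⟨ cong₂ _++_ (trans (sym (map-∘ ys)) (map-∘ ys)) (mulP-map f g xs ys) ⟩
  map h (map (x ,_) ys) ++ map h (cartesianProduct xs ys)
    ≡⟨ map-++ h (map (x ,_) ys) _ ⟨
  map h (cartesianProduct (x ∷ xs) ys)
    ∎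
  where
  open ≡-Reasoning
  h : A × B → Mono
  h (x , y) = mulM (f x) (g y)

shiftP-mulP : ∀ u v w t → u + v ≡ w + t → ∀ xs ys →
  shiftP v (mulP xs (shiftP u ys)) ≡ mulP (shiftP w xs) (shiftP t ys)
shiftP-mulP u v w t u+v≡w+t []             ys = refl
shiftP-mulP u v w t u+v≡w+t ((e , λ₁) ∷ xs) ys =
  trans (map-++ _ (map (mulM (e , λ₁)) (shiftP u ys)) _)
    (cong₂ _++_ (row ys) (shiftP-mulP u v w t u+v≡w+t xs ys))
  where
  open +-*-Solver
  exponent : ∀ e′ → e + (e′ + u) + v ≡ e + w + (e′ + t)
  exponent e′ = begin
    e + (e′ + u) + v
      ≡⟨ solve 4 (λ e e′ u v → e :+ (e′ :+ u) :+ v := e :+ e′ :+ (u :+ v)) refl e e′ u v ⟩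
    e + e′ + (u + v)
      ≡⟨ cong (e + e′ +_) u+v≡w+t ⟩
    e + e′ + (w + t)
      ≡⟨ solve 4 (λ e e′ w t → e :+ e′ :+ (w :+ t) := e :+ w :+ (e′ :+ t)) refl e e′ w t ⟩
    e + w + (e′ + t)
      ∎
    where open ≡-Reasoning
  row : ∀ ys → shiftP v (map (mulM (e , λ₁)) (shiftP u ys)) ≡ map (mulM (e + w , λ₁)) (shiftP t ys)
  row []               = refl
  row ((e′ , μ) ∷ ys) = cong₂ _∷_ (cong (_, sort (λ₁ ++ μ)) (exponent e′)) (row ys)

mulP-↭ʳ : ∀ xs {ys zs} → ys ↭ zs → mulP xs ys ↭ mulP xs zs
mulP-↭ʳ xs ys↭zs = concatMap-↭ xs (λ x → ↭.map⁺ (mulM x) ys↭zs)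

shiftP-zero : ∀ xs → shiftP 0 xs ≡ xs
shiftP-zero []              = refl
shiftP-zero ((e , λ₁) ∷ xs) = cong₂ _∷_ (cong (_, λ₁) (+-identityʳ e)) (shiftP-zero xs)

-- Parking bounds

module _ (r : ℕ) where

  -- j is the 0-based position of the head of the list.
  data ParkBounded (k : ℕ) : ℕ → List ℕ → Set where
    []  : ∀ {j} → ParkBounded k j []
    _∷_ : ∀ {j b bs} → 1 ≤ b × b ≤ k + j * r → ParkBounded k (suc j) bs →
          ParkBounded k j (b ∷ bs)

  ParkBounded⇒parkBoundFrom : ∀ {k j b} → ParkBounded k j b → T (parkBoundFrom r k (suc j) b)
  ParkBounded⇒parkBoundFrom []                 = tt
  ParkBounded⇒parkBoundFrom ((1≤b , b≤) ∷ pb) =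
    Equivalence.from T-∧ (≤⇒≤ᵇ 1≤b ,
      Equivalence.from T-∧ (≤⇒≤ᵇ b≤ , ParkBounded⇒parkBoundFrom pb))

  parkBoundFrom⇒ParkBounded : ∀ k j b → T (parkBoundFrom r k (suc j) b) → ParkBounded k j b
  parkBoundFrom⇒ParkBounded k j []       _ = []
  parkBoundFrom⇒ParkBounded k j (b ∷ bs) t =
    let 1≤ᵇb , t′ = Equivalence.to (T-∧ {1 ≤ᵇ b}) t
        b≤ᵇ  , t″ = Equivalence.to (T-∧ {b ≤ᵇ k + j * r}) t′
    in (≤ᵇ⇒≤ 1 b 1≤ᵇb , ≤ᵇ⇒≤ b _ b≤ᵇ) ∷ parkBoundFrom⇒ParkBounded k (suc j) bs t″

  ParkBounded-All : ∀ {k j b} → ParkBounded k j b →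
    All (λ x → 1 ≤ x × x ≤ k + (j + length b ∸ 1) * r) b
  ParkBounded-All []                                  = []
  ParkBounded-All {k} {j} {_ ∷ bs} ((1≤b , b≤) ∷ pb) =
    (1≤b , ≤-trans b≤ (+-monoʳ-≤ k (*-monoˡ-≤ r (subst (j ≤_) (sym last≡) (m≤m+n j (length bs))))))
    ∷ subst (λ i → All (λ x → 1 ≤ x × x ≤ k + i * r) bs) (sym last≡) (ParkBounded-All pb)
    where
    last≡ : j + suc (length bs) ∸ 1 ≡ j + length bs
    last≡ = cong (_∸ 1) (+-suc j (length bs))

  ParkBounded⇒1≤ : ∀ {k j b} → ParkBounded k j b → All (1 ≤_) b
  ParkBounded⇒1≤ = All.map proj₁ ∘ ParkBounded-All

  ParkBounded⇒≤ : ∀ {k b} → ParkBounded k 0 b → All (_≤ k + length b * r) b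
  ParkBounded⇒≤ {k} {b} =
    All.map (λ (_ , x≤) → ≤-trans x≤ (+-monoʳ-≤ k (*-monoˡ-≤ r (m∸n≤m (length b) 1))))
    ∘ ParkBounded-All

  ParkBounded-suc : ∀ {k j b} → ParkBounded k j b → ParkBounded (suc k) j b
  ParkBounded-suc []                 = []
  ParkBounded-suc ((1≤b , b≤) ∷ pb) = (1≤b , m≤n⇒m≤1+n b≤) ∷ ParkBounded-suc pb

  ParkBounded-++ : ∀ {k j c e} → ParkBounded k j c → ParkBounded k (j + length c) e →
    ParkBounded k j (c ++ e)
  ParkBounded-++ {k} {j} {e = e} []                pe = subst (λ i → ParkBounded k i e) (+-identityʳ j) pe
  ParkBounded-++ {k} {j} {e = e} (bnd ∷ pc) pe =
    bnd ∷ ParkBounded-++ pc (subst (λ i → ParkBounded k i e) (+-suc j _) pe)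

  ParkBounded-drop : ∀ {k j b} → ParkBounded k j b → ∀ n → ParkBounded k (j + n) (drop n b)
  ParkBounded-drop {k} {j} pb       zero    = subst (λ i → ParkBounded k i _) (sym (+-identityʳ j)) pb
  ParkBounded-drop         []       (suc n) = []
  ParkBounded-drop {k} {j} (_∷_ {bs = bs} _ pb) (suc n) =
    subst (λ i → ParkBounded k i (drop n bs)) (sym (+-suc j n)) (ParkBounded-drop pb n)

  shifted-bound : ∀ k p i → 1 + i * r + (k + p * r) ≡ suc k + (p + i) * r
  shifted-bound =
    solve 4 (λ r k p i → con 1 :+ i :* r :+ (k :+ p :* r) := con 1 :+ k :+ (p :+ i) :* r) refl r
    where open +-*-Solver

  ParkBounded-shift : ∀ k p {i d} → ParkBounded 1 i d →
    ParkBounded (suc k) (p + i) (map (_+ (k + p * r)) d)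
  ParkBounded-shift k p []                                  = []
  ParkBounded-shift k p {i} (_∷_ {b = x} {bs} (1≤x , x≤) pd) =
    (≤-trans 1≤x (m≤m+n x _) , ≤-trans (+-monoˡ-≤ (k + p * r) x≤) (≤-reflexive (shifted-bound k p i)))
    ∷ subst (λ j → ParkBounded (suc k) j (map (_+ (k + p * r)) bs)) (+-suc p i) (ParkBounded-shift k p pd)

  ParkBounded-unshift : ∀ k p {i w} → All (k + p * r <_) w → ParkBounded (suc k) (p + i) w →
    ParkBounded 1 i (map (_∸ (k + p * r)) w)
  ParkBounded-unshift k p []          []                           = []
  ParkBounded-unshift k p {i} (s<x ∷ s<w) (_∷_ {b = x} {bs} (_ , x≤) pw) =
    (m<n⇒0<n∸m s<x , ≤-trans (∸-monoˡ-≤ s x≤) (≤-reflexive unshifted-bound))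
    ∷ ParkBounded-unshift k p s<w (subst (λ j → ParkBounded (suc k) j bs) (sym (+-suc p i)) pw)
    where
    s : ℕ
    s = k + p * r
    unshifted-bound : suc k + (p + i) * r ∸ s ≡ 1 + i * r
    unshifted-bound = trans (cong (_∸ s) (sym (shifted-bound k p i))) (m+n∸n≡m (1 + i * r) s)

  isWIPF? : ∀ k b → Dec (T (isWIPF r k b))
  isWIPF? k b = T? (isWIPF r k b)

  IsWIPF : ℕ → List ℕ → Set
  IsWIPF k b = Linked _≤_ b × ParkBounded k 0 b

  ∈-WIPF⁻ : ∀ k n {b} → b ∈ WIPF r k n → length b ≡ n × IsWIPF k b
  ∈-WIPF⁻ k n {b} b∈ =
    let b∈seqs , t = ∈-filter⁻ (isWIPF? k) {xs = seqs (k + (n ∸ 1) * r) n} b∈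
        t₁ , t₂ = Equivalence.to (T-∧ {isWeaklyIncr b}) t
    in ∈-seqs⁻ _ n b∈seqs , isWeaklyIncr⇒Linked b t₁ , parkBoundFrom⇒ParkBounded k 0 b t₂

  ∈-WIPF⁺ : ∀ k {b} → IsWIPF k b → b ∈ WIPF r k (length b)
  ∈-WIPF⁺ k (wb , pb) = ∈-filter⁺ (isWIPF? k) (∈-seqs⁺ _ (ParkBounded-All pb))
    (Equivalence.from T-∧ (Linked⇒isWeaklyIncr wb , ParkBounded⇒parkBoundFrom pb))

  WIPF-unique : ∀ k n → Unique (WIPF r k n)
  WIPF-unique k n = Unique.filter⁺ (isWIPF? k) (seqs-unique _ n)

  -- Splitting

  splitLength : ℕ → ℕ → List ℕ → ℕ
  splitLength k j []       = 0
  splitLength k j (x ∷ xs) with x ≤? k + j * r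
  ... | yes _ = suc (splitLength k (suc j) xs)
  ... | no  _ = 0

  splitLength-≤ : ∀ k j b → splitLength k j b ≤ length b
  splitLength-≤ k j []       = z≤n
  splitLength-≤ k j (x ∷ xs) with x ≤? k + j * r
  ... | yes _ = s≤s (splitLength-≤ k (suc j) xs)
  ... | no  _ = z≤n

  splitLength-++ : ∀ {k j c w} → ParkBounded k j c → All (k + (j + length c) * r <_) w →
    splitLength k j (c ++ w) ≡ length c
  splitLength-++ {w = []} [] _ = refl
  splitLength-++ {k} {j} {w = y ∷ w} [] (above ∷ _) with y ≤? k + j * r
  ... | yes y≤ = ⊥-elim (<⇒≱ above (subst (λ i → y ≤ k + i * r) (sym (+-identityʳ j)) y≤))
  ... | no  _  = refl
  splitLength-++ {k} {j} {w = w} (_∷_ {b = x} {bs} (_ , x≤) pc) above with x ≤? k + j * r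
  ... | yes _  =
    cong suc (splitLength-++ pc (subst (λ i → All (k + i * r <_) w) (+-suc j (length bs)) above))
  ... | no  x≰ = ⊥-elim (x≰ x≤)

  ParkBounded-take-split : ∀ {k j b} → ParkBounded (suc k) j b →
    ParkBounded k j (take (splitLength k j b) b)
  ParkBounded-take-split []                                = []
  ParkBounded-take-split {k} {j} (_∷_ {b = x} (1≤x , _) pb) with x ≤? k + j * r
  ... | yes x≤ = (1≤x , x≤) ∷ ParkBounded-take-split pb
  ... | no  _  = []

  drop-split-above : ∀ {k j b} → Linked _≤_ b →
    All (k + (j + splitLength k j b) * r <_) (drop (splitLength k j b) b)
  drop-split-above {b = []}             _  = []
  drop-split-above {k} {j} {b = x ∷ xs} wb with x ≤? k + j * r
  ... | yes _  = subst (λ i → All (k + i * r <_) (drop (splitLength k (suc j) xs) xs)) (sym (+-suc j _))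
                   (drop-split-above (Linked.tail wb))
  ... | no  x≰ =
    Linked.Linked⇒All ≤-trans (subst (λ i → k + i * r < x) (sym (+-identityʳ j)) (≰⇒> x≰)) wb

  glue : ℕ → List ℕ × List ℕ → List ℕ
  glue k (d , c) = c ++ map (_+ (k + length c * r)) d

  glue-IsWIPF : ∀ k {d c} → IsWIPF 1 d → IsWIPF k c → IsWIPF (suc k) (glue k (d , c))
  glue-IsWIPF k {d} {c} (wd , pd) (wc , pc) =
    Linked-++⁺ wc (Linked.map⁺ (Linked.map (+-monoˡ-≤ s) wd)) c≤shifted-d ,
    ParkBounded-++ (ParkBounded-suc pc)
      (subst (λ j → ParkBounded (suc k) j (map (_+ s) d)) (+-identityʳ (length c))
        (ParkBounded-shift k (length c) pd))
    where
    s : ℕ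
    s = k + length c * r
    c≤shifted-d : ∀ {x y} → x ∈ c → y ∈ map (_+ s) d → x ≤ y
    c≤shifted-d x∈ y∈ = let z , _ , y≡ = ∈-map⁻ (_+ s) y∈ in
      subst (_ ≤_) (sym y≡) (≤-trans (All.lookup (ParkBounded⇒≤ pc) x∈) (m≤n+m s z))

  glue-split : ∀ k {b} → IsWIPF (suc k) b →
    ∃₂ λ d c → IsWIPF 1 d × IsWIPF k c × b ≡ glue k (d , c)
  glue-split k {b} (wb , pb) = d , c , (wd , pd) , (Linked-take p wb , ParkBounded-take-split pb) , b≡glue
    where
    p s : ℕ
    p = splitLength k 0 b
    s = k + p * r
    c w d : List ℕ
    c = take p b
    w = drop p b
    d = map (_∸ s) w
    w-above : All (s <_) w
    w-above = drop-split-above wb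
    wd : Linked _≤_ d
    wd = Linked.map⁺ (Linked.map (∸-monoˡ-≤ s) (Linked-drop p wb))
    pd : ParkBounded 1 0 d
    pd = ParkBounded-unshift k p w-above
           (subst (λ j → ParkBounded (suc k) j w) (sym (+-identityʳ p)) (ParkBounded-drop pb p))
    |c|≡p : length c ≡ p
    |c|≡p = trans (length-take p b) (m≤n⇒m⊓n≡m (splitLength-≤ k 0 b))
    w≡shifted-d : w ≡ map (_+ s) d
    w≡shifted-d = sym (trans (sym (map-∘ w)) (map-id-local (All.map (m∸n+n≡m ∘ <⇒≤) w-above)))
    b≡glue : b ≡ glue k (d , c)
    b≡glue = trans (sym (take++drop≡id p b))
      (cong (c ++_) (trans w≡shifted-d (cong (λ l → map (_+ (k + l * r)) d) (sym |c|≡p))))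

  splitLength-glue : ∀ k {d c} → ParkBounded 1 0 d → ParkBounded k 0 c →
    splitLength k 0 (glue k (d , c)) ≡ length c
  splitLength-glue k pd pc = splitLength-++ pc (All.map⁺ (All.map (m<n+m _) (ParkBounded⇒1≤ pd)))

  glue-injective : ∀ k {d c d′ c′} → IsWIPF 1 d → IsWIPF k c → IsWIPF 1 d′ → IsWIPF k c′ →
    glue k (d , c) ≡ glue k (d′ , c′) → (d , c) ≡ (d′ , c′)
  glue-injective k {d} {c} {d′} {c′} (_ , pd) (_ , pc) (_ , pd′) (_ , pc′) glue≡ =
    cong₂ _,_ (map-injective (+-cancelʳ-≡ _ _ _) shifted≡) c≡c′
    where
    |c|≡|c′| : length c ≡ length c′
    |c|≡|c′| = begin
      length c                           ≡⟨ splitLength-glue k pd pc ⟨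
      splitLength k 0 (glue k (d , c))   ≡⟨ cong (splitLength k 0) glue≡ ⟩
      splitLength k 0 (glue k (d′ , c′)) ≡⟨ splitLength-glue k pd′ pc′ ⟩
      length c′                          ∎
      where open ≡-Reasoning
    c≡c′ : c ≡ c′
    c≡c′ = proj₁ (++-injective |c|≡|c′| glue≡)
    shifted≡ : map (_+ (k + length c′ * r)) d ≡ map (_+ (k + length c′ * r)) d′
    shifted≡ = subst (λ l → map (_+ (k + l * r)) d ≡ map (_+ (k + length c′ * r)) d′) |c|≡|c′|
      (proj₂ (++-injective |c|≡|c′| glue≡))

  length-glue : ∀ k d c → length (glue k (d , c)) ≡ length c + length d
  length-glue k d c = trans (length-++ c) (cong (length c +_) (length-map _ d))

  gluePairsAt : ℕ → ℕ → ℕ → List (List ℕ × List ℕ)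
  gluePairsAt k n m = cartesianProduct (WIPF r 1 m) (WIPF r k (n ∸ m))

  gluePairs : ℕ → ℕ → List (List ℕ × List ℕ)
  gluePairs k n = concatMap (gluePairsAt k n) (range 0 (suc n))

  ∈-gluePairsAt⁻ : ∀ k n m {d c} → (d , c) ∈ gluePairsAt k n m →
    (length d ≡ m × IsWIPF 1 d) × (length c ≡ n ∸ m × IsWIPF k c)
  ∈-gluePairsAt⁻ k n m dc∈ =
    let d∈ , c∈ = ∈-cartesianProduct⁻ (WIPF r 1 m) (WIPF r k (n ∸ m)) dc∈
    in ∈-WIPF⁻ 1 m d∈ , ∈-WIPF⁻ k (n ∸ m) c∈

  ∈-gluePairs⁻ : ∀ k n {d c} → (d , c) ∈ gluePairs k n →
    IsWIPF 1 d × IsWIPF k c × length c + length d ≡ n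
  ∈-gluePairs⁻ k n dc∈ =
    let m , m∈ , dc∈m = ∈-concatMap⁻′ (gluePairsAt k n) (range 0 (suc n)) dc∈
        (|d|≡m , d-wipf) , (|c|≡n∸m , c-wipf) = ∈-gluePairsAt⁻ k n m dc∈m
    in d-wipf , c-wipf ,
       trans (cong₂ _+_ |c|≡n∸m |d|≡m) (m∸n+n≡m (≤-pred (proj₂ (∈-range⁻ m∈))))

  ∈-gluePairs⁺ : ∀ k {d c} → IsWIPF 1 d → IsWIPF k c → (d , c) ∈ gluePairs k (length c + length d)
  ∈-gluePairs⁺ k {d} {c} d-wipf c-wipf =
    ∈-concatMap⁺′ (gluePairsAt k (length c + length d))
      (∈-range⁺ z≤n (s≤s (m≤n+m (length d) (length c))))
      (∈-cartesianProduct⁺ (∈-WIPF⁺ 1 d-wipf)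
        (subst (λ l → c ∈ WIPF r k l) (sym (m+n∸n≡m (length c) (length d))) (∈-WIPF⁺ k c-wipf)))

  gluePairs-unique : ∀ k n → Unique (gluePairs k n)
  gluePairs-unique k n =
    Unique-concatMap⁺ (gluePairsAt k n) (range-unique 0 (suc n))
      (λ {m} _ → Unique.cartesianProduct⁺ (WIPF-unique 1 m) (WIPF-unique k (n ∸ m)))
      λ {m} {m′} _ _ dc∈m dc∈m′ →
        trans (sym (proj₁ (proj₁ (∈-gluePairsAt⁻ k n m dc∈m))))
              (proj₁ (proj₁ (∈-gluePairsAt⁻ k n m′ dc∈m′)))

  WIPF-suc-↭ : ∀ k n → WIPF r (suc k) n ↭ map (glue k) (gluePairs k n)
  WIPF-suc-↭ k n =
    ∼bag⇒↭ (unique∧set⇒bag (WIPF-unique (suc k) n) gluings-unique (mk⇔ split joined))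
    where
    gluings-unique : Unique (map (glue k) (gluePairs k n))
    gluings-unique = Unique-map⁺
      (λ dc∈ dc′∈ →
        let d-wipf , c-wipf , _ = ∈-gluePairs⁻ k n dc∈
            d′-wipf , c′-wipf , _ = ∈-gluePairs⁻ k n dc′∈
        in glue-injective k d-wipf c-wipf d′-wipf c′-wipf)
      (gluePairs-unique k n)
    split : ∀ {b} → b ∈ WIPF r (suc k) n → b ∈ map (glue k) (gluePairs k n)
    split b∈ with ∈-WIPF⁻ (suc k) n b∈
    ... | refl , b-wipf with glue-split k b-wipf
    ... | d , c , d-wipf , c-wipf , refl = ∈-map⁺ (glue k)
      (subst (λ l → (d , c) ∈ gluePairs k l) (sym (length-glue k d c)) (∈-gluePairs⁺ k d-wipf c-wipf))
    joined : ∀ {b} → b ∈ map (glue k) (gluePairs k n) → b ∈ WIPF r (suc k) n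
    joined b∈ with ∈-map⁻ (glue k) b∈
    ... | (d , c) , dc∈ , refl =
      let d-wipf , c-wipf , |c|+|d|≡n = ∈-gluePairs⁻ k n dc∈ in
      subst (λ l → glue k (d , c) ∈ WIPF r (suc k) l) (trans (length-glue k d c) |c|+|d|≡n)
        (∈-WIPF⁺ (suc k) (glue-IsWIPF k d-wipf c-wipf))

  -- The recursion for F

  sum-≤ : ∀ {k j b} → ParkBounded k j b → sum b ≤ k * length b + (j * length b + length b C 2) * r
  sum-≤ []                                  = z≤n
  sum-≤ {k} {j} {_ ∷ bs} ((_ , b≤) ∷ pb) =
    ≤-trans (+-mono-≤ b≤ (sum-≤ pb)) (≤-reflexive bounds-sum)
    where
    open +-*-Solver
    l : ℕ
    l = length bs
    bounds-sum : k + j * r + (k * l + (suc j * l + l C 2) * r) ≡ k * suc l + (j * suc l + suc l C 2) * r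
    bounds-sum = trans
      (solve 5 (λ k j r l l₂ → k :+ j :* r :+ (k :* l :+ ((con 1 :+ j) :* l :+ l₂) :* r)
                            := k :* (con 1 :+ l) :+ (j :* (con 1 :+ l) :+ (l :+ l₂)) :* r)
         refl k j r l (l C 2))
      (cong (λ x → k * suc l + (j * suc l + x) * r) (sym (suc-C2 l)))

  stat+sum : ∀ {k b} → ParkBounded k 0 b → stat r k b + sum b ≡ k * length b + (length b C 2) * r
  stat+sum pb = m∸n+n≡m (sum-≤ pb)

  stat-glue : ∀ k {d c} → IsWIPF 1 d → IsWIPF k c →
    stat r (suc k) (glue k (d , c)) ≡ stat r 1 d + (stat r k c + length c)
  stat-glue k {d} {c} d-wipf c-wipf = +-cancelʳ-≡ (sum b) _ _ (begin
    stat r (suc k) b + sum b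
      ≡⟨ stat+sum (proj₂ (glue-IsWIPF k d-wipf c-wipf)) ⟩
    suc k * length b + (length b C 2) * r
      ≡⟨ cong (λ l → suc k * l + (l C 2) * r) (length-glue k d c) ⟩
    suc k * (p + m) + ((p + m) C 2) * r
      ≡⟨ cong (λ x → suc k * (p + m) + x * r) (+-C2 p m) ⟩
    suc k * (p + m) + (p C 2 + m C 2 + p * m) * r
      ≡⟨ solve 6 (λ k p m p₂ m₂ r → (con 1 :+ k) :* (p :+ m) :+ (p₂ :+ m₂ :+ p :* m) :* r
                   := (k :* p :+ p₂ :* r) :+ (con 1 :* m :+ m₂ :* r) :+ p :+ m :* (k :+ p :* r))
                 refl k p m (p C 2) (m C 2) r ⟩
    (k * p + (p C 2) * r) + (1 * m + (m C 2) * r) + p + m * s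
      ≡⟨ cong₂ (λ x y → x + y + p + m * s) (stat+sum (proj₂ c-wipf)) (stat+sum (proj₂ d-wipf)) ⟨
    (stat r k c + sum c) + (stat r 1 d + sum d) + p + m * s
      ≡⟨ solve 6 (λ σc Σc σd Σd p ms → σc :+ Σc :+ (σd :+ Σd) :+ p :+ ms
                                      := σd :+ (σc :+ p) :+ (Σc :+ (Σd :+ ms)))
                 refl (stat r k c) (sum c) (stat r 1 d) (sum d) p (m * s) ⟩
    stat r 1 d + (stat r k c + p) + (sum c + (sum d + m * s))
      ≡⟨ cong (stat r 1 d + (stat r k c + p) +_) (sym sum-glue) ⟩
    stat r 1 d + (stat r k c + p) + sum b ∎)
    where
    open ≡-Reasoning
    open +-*-Solver
    p m s : ℕ
    p = length c
    m = length d
    s = k + p * r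
    b : List ℕ
    b = glue k (d , c)
    sum-glue : sum b ≡ sum c + (sum d + m * s)
    sum-glue = trans (sum-++ c _) (cong (sum c +_) (sum-shift s d))

  monoOf-glue : ∀ k {d c} → IsWIPF 1 d → IsWIPF k c →
    monoOf r (suc k) (glue k (d , c)) ≡ mulM (monoOf r 1 d) (stat r k c + length c , multiplicities c)
  monoOf-glue k d-wipf c-wipf = cong₂ _,_ (stat-glue k d-wipf c-wipf)
    (multiplicities-glue _ (ParkBounded⇒≤ (proj₂ c-wipf)) (ParkBounded⇒1≤ (proj₂ d-wipf)))

  -- Summand m of the coefficient of t^n in P^{(r,1)}(q,t) P^{(r,k)}(q,qt).
  convolutionTerm : ℕ → ℕ → ℕ → Poly
  convolutionTerm k n m = mulP (F r 1 m) (shiftP (n ∸ m) (F r k (n ∸ m)))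

  monoOf-gluePairsAt : ∀ k n m →
    map (monoOf r (suc k) ∘ glue k) (gluePairsAt k n m) ≡ convolutionTerm k n m
  monoOf-gluePairsAt k n m = begin
    map (monoOf r (suc k) ∘ glue k) (gluePairsAt k n m)
      ≡⟨ map-cong-local (All.tabulate glued) ⟩
    map (λ (d , c) → mulM (monoOf r 1 d) (cShifted c)) (gluePairsAt k n m)
      ≡⟨ mulP-map (monoOf r 1) cShifted (WIPF r 1 m) (WIPF r k (n ∸ m)) ⟨
    mulP (F r 1 m) (map cShifted (WIPF r k (n ∸ m)))
      ≡⟨ cong (mulP (F r 1 m)) (map-∘ (WIPF r k (n ∸ m))) ⟩
    convolutionTerm k n m
      ∎
    where
    open ≡-Reasoning
    cShifted : List ℕ → Mono
    cShifted c = stat r k c + (n ∸ m) , multiplicities c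
    glued : ∀ {dc} → dc ∈ gluePairsAt k n m →
      monoOf r (suc k) (glue k dc) ≡ mulM (monoOf r 1 (proj₁ dc)) (cShifted (proj₂ dc))
    glued {d , c} dc∈ =
      let (_ , d-wipf) , (|c|≡n∸m , c-wipf) = ∈-gluePairsAt⁻ k n m dc∈
      in subst (λ l → monoOf r (suc k) (glue k (d , c))
                        ≡ mulM (monoOf r 1 d) (stat r k c + l , multiplicities c))
           |c|≡n∸m (monoOf-glue k d-wipf c-wipf)

  F-suc-↭ : ∀ k n → F r (suc k) n ↭ concatMap (convolutionTerm k n) (range 0 (suc n))
  F-suc-↭ k n = begin
    map (monoOf r (suc k)) (WIPF r (suc k) n)
      ↭⟨ ↭.map⁺ (monoOf r (suc k)) (WIPF-suc-↭ k n) ⟩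
    map (monoOf r (suc k)) (map (glue k) (gluePairs k n))
      ≡⟨ map-∘ (gluePairs k n) ⟨
    map (monoOf r (suc k) ∘ glue k) (gluePairs k n)
      ≡⟨ map-concatMap _ (gluePairsAt k n) (range 0 (suc n)) ⟩
    concatMap (map (monoOf r (suc k) ∘ glue k) ∘ gluePairsAt k n) (range 0 (suc n))
      ≡⟨ concatMap-cong-∈ (range 0 (suc n)) (λ {m} _ → monoOf-gluePairsAt k n m) ⟩
    concatMap (convolutionTerm k n) (range 0 (suc n))
      ∎
    where open PermutationReasoning

  WIPF-zero-suc : ∀ n → WIPF r 0 (suc n) ≡ []
  WIPF-zero-suc n = empty (WIPF r 0 (suc n)) λ b∈ → no-first-entry (∈-WIPF⁻ 0 (suc n) b∈)
    where
    empty : ∀ (xs : List (List ℕ)) → (∀ {x} → ¬ x ∈ xs) → xs ≡ []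
    empty []      _ = refl
    empty (_ ∷ _) ∉ = ⊥-elim (∉ (here refl))
    no-first-entry : ∀ {b} → ¬ (length b ≡ suc n × IsWIPF 0 b)
    no-first-entry (() , _ , [])
    no-first-entry (_  , _ , (1≤x , x≤0) ∷ _) with () ← ≤-trans 1≤x x≤0

  prodCoeff-range : ∀ k a n → prodCoeff r (range a k) n ↭ shiftP (a * n) (F r k n)
  prodCoeff-range zero    a zero    = ↭-reflexive (cong (λ e → (e , []) ∷ []) (sym (*-zeroʳ a)))
  prodCoeff-range zero    a (suc n) =
    ↭-reflexive (cong (shiftP (a * suc n) ∘ map (monoOf r 0)) (sym (WIPF-zero-suc n)))
  prodCoeff-range (suc k) a n = begin
    concatMap (λ m → mulP (shifted₁ m) (prodCoeff r (range (suc a) k) (n ∸ m))) R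
      ↭⟨ concatMap-↭ R (λ m → mulP-↭ʳ (shifted₁ m) (prodCoeff-range k (suc a) (n ∸ m))) ⟩
    concatMap (λ m → mulP (shifted₁ m) (shiftP (suc a * (n ∸ m)) (F r k (n ∸ m)))) R
      ≡⟨ concatMap-cong-∈ R shift-out ⟩
    concatMap (shiftP (a * n) ∘ convolutionTerm k n) R
      ≡⟨ map-concatMap _ (convolutionTerm k n) R ⟨
    shiftP (a * n) (concatMap (convolutionTerm k n) R)
      ↭⟨ ↭.map⁺ _ (F-suc-↭ k n) ⟨
    shiftP (a * n) (F r (suc k) n)
      ∎
    where
    open PermutationReasoning
    open +-*-Solver
    R : List ℕ
    R = range 0 (suc n)
    shifted₁ : ℕ → Poly
    shifted₁ m = shiftP (a * m) (F r 1 m)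
    shift-out : ∀ {m} → m ∈ R →
      mulP (shifted₁ m) (shiftP (suc a * (n ∸ m)) (F r k (n ∸ m)))
        ≡ shiftP (a * n) (convolutionTerm k n m)
    shift-out {m} m∈ = sym (shiftP-mulP (n ∸ m) (a * n) (a * m) (suc a * (n ∸ m))
      (subst (λ x → n ∸ m + a * x ≡ a * m + suc a * (n ∸ m))
        (m+[n∸m]≡n (≤-pred (proj₂ (∈-range⁻ m∈))))
        (solve 3 (λ a m q → q :+ a :* (m :+ q) := a :* m :+ (con 1 :+ a) :* q) refl a m (n ∸ m)))
      (F r 1 m) (F r k (n ∸ m)))

theorem3p3 : (r k : ℕ) → 0 < r → 0 < k →
    (n : ℕ) → F r k n ↭ prodCoeff r (upto k) n
theorem3p3 r k _ _ n = begin
  F r k n                  ≡⟨ shiftP-zero (F r k n) ⟨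
  shiftP 0 (F r k n)       ↭⟨ prodCoeff-range r k 0 n ⟨
  prodCoeff r (upto k) n   ∎
  where open PermutationReasoning
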